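{- For all positive integers $n$ and $k$, the quadrilateral snake $Q_n$ is a $k$-geometric mean graph.
   Context: For the path $u_1u_2\dots u_n$, the quadrilateral snake $Q_n$ is obtained by adding, for each $1\le i\le n-1$, two new vertices $v_i,w_i$ together with the edges $u_iv_i$, $v_iw_i$, $w_iu_{i+1}$ (so each edge $u_iu_{i+1}$ of the path lies on the $4$-cycle $u_iv_iw_iu_{i+1}$). Let $k$ be a positive integer. A finite simple graph $G$ with $p$ vertices and $q$ edges is a $k$-geometric mean graph if there is an injection $\psi: V(G)\to\{k,k+1,\dots,k+q\}$ such that, when each edge $uv$ is assigned one of the labels $\lfloor\sqrt{\psi(u)\psi(v)}\rfloor$ or $\lceil\sqrt{\psi(u)\psi(v)}\rceil$ (chosen per edge), the resulting set of edge labels is exactly $\{k,k+1,\dots,k+q-1\}$. -}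

module Defs where

open import Data.Nat using (ℕ; zero; suc; _+_; _*_; _≤_; _<_)
open import Data.Fin using (Fin; inject₁) renaming (suc to fsuc)
open import Data.List using (List; []; _∷_; length; concatMap; allFin)
open import Data.List.Membership.Propositional using (_∈_)
open import Data.List.Relation.Binary.Pointwise using (Pointwise)
open import Data.Product using (_×_; _,_; Σ)
open import Data.Sum using (_⊎_)
open import Data.Empty using (⊥)
open import Function.Definitions using (Injective)
open import Relation.Binary.PropositionalEquality using (_≡_)

-- A finite graph given by a vertex type and its list of edges
-- (each unordered edge listed exactly once).
record Graph : Set₁ where
  field
    V     : Set
    edges : List (V × V)

open Graph public

size : Graph → ℕ
size G = length (edges G)

FloorSqrt : ℕ → ℕ → Set
FloorSqrt x l = (l * l ≤ x) × (∀ j → j * j ≤ x → j ≤ l)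

CeilSqrt : ℕ → ℕ → Set
CeilSqrt x l = (x ≤ l * l) × (∀ j → x ≤ j * j → l ≤ j)

GeoLabel : ℕ → ℕ → ℕ → Set
GeoLabel a b l = FloorSqrt (a * b) l ⊎ CeilSqrt (a * b) l

IsKGeometricMean : ℕ → Graph → Set
IsKGeometricMean k G =
  Σ (V G → ℕ) λ ψ →
    Injective _≡_ _≡_ ψ
    × (∀ x → k ≤ ψ x × ψ x ≤ k + size G)
    × Σ (List ℕ) λ L →
        Pointwise (λ e l → GeoLabel (ψ (Data.Product.proj₁ e)) (ψ (Data.Product.proj₂ e)) l) (edges G) L
        × (∀ l → l ∈ L → k ≤ l × l < k + size G)
        × (∀ m → k ≤ m → m < k + size G → m ∈ L)

-- vertices of the quadrilateral snake Q_{m+1}: u_0..u_m, v_0..v_{m-1}, w_0..w_{m-1}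
data QV (m : ℕ) : Set where
  u : Fin (suc m) → QV m
  v : Fin m → QV m
  w : Fin m → QV m

qEdges : (m : ℕ) → Fin m → List (QV m × QV m)
qEdges m i =
  (u (inject₁ i) , u (fsuc i)) ∷ (u (inject₁ i) , v i) ∷ (v i , w i) ∷ (w i , u (fsuc i)) ∷ []

-- Q n ; Q 0 is the empty graph (not used)
Q : ℕ → Graph
Q zero = record { V = ⊥ ; edges = [] }
Q (suc m) = record { V = QV m ; edges = concatMap (qEdges m) (allFin m) }

module Submission where

-- Split the label range k, …, k + 4m into m blocks of four.  The
-- i-th square u_i v_i w_i u_{i+1} has base b = 4i + k and its vertices get
--   ψ(u_i) = b,  ψ(v_i) = b + 1,  ψ(w_i) = b + 3,  ψ(u_{i+1}) = b + 4,
-- while its edges u_iu_{i+1}, u_iv_i, v_iw_i, w_iu_{i+1} get b+2, b, b+1, b+3.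

open import Defs
open import Data.Nat using (ℕ; suc; _+_; _*_; _∸_; _≤_; _<_; z≤n; s≤s; s≤s⁻¹; _%_; _/_; NonZero)
open import Data.Nat.Properties
open import Data.Nat.DivMod using (m≡m%n+[m/n]*n; [m+kn]%n≡m%n; m<n⇒m%n≡m; m%n<n; m<n*o⇒m/o<n)
open import Data.Nat.Tactic.RingSolver using (solve-∀)
open import Data.Fin using (Fin; toℕ; inject₁; fromℕ<)
open import Data.Fin.Properties using (toℕ-injective; toℕ-inject₁; toℕ-fromℕ<; toℕ<n)
open import Data.List using (List; []; _∷_; length; map; concatMap; allFin)
open import Data.List.Properties using (length-++; length-tabulate)
open import Data.List.Membership.Propositional using (_∈_; lose)
open import Data.List.Membership.Propositional.Properties using (∈-map⁺; ∈-map⁻; ∈-concatMap⁺; ∈-concatMap⁻; ∈-allFin)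
open import Data.List.Relation.Unary.Any using (here; there; satisfied)
open import Data.List.Relation.Binary.Pointwise using (Pointwise; []; _∷_; ++⁺)
open import Data.Product using (_×_; _,_; Σ; proj₁; proj₂)
open import Data.Sum using (inj₁; inj₂)
open import Function.Definitions using (Injective)
open import Relation.Binary.PropositionalEquality

floorSqrt-intro : ∀ x l → l * l ≤ x → x < suc l * suc l → FloorSqrt x l
floorSqrt-intro x l l²≤x x<[1+l]² = l²≤x , λ j j²≤x → ≮⇒≥ λ l<j →
  <⇒≱ x<[1+l]² (≤-trans (*-mono-≤ l<j l<j) j²≤x)

ceilSqrt-intro : ∀ x p → p * p < x → x ≤ suc p * suc p → CeilSqrt x (suc p)
ceilSqrt-intro x p p²<x x≤[1+p]² = x≤[1+p]² , λ j x≤j² → ≮⇒≥ λ j<1+p →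
  let j≤p = s≤s⁻¹ j<1+p in <⇒≱ p²<x (≤-trans x≤j² (*-mono-≤ j≤p j≤p))

-- ⌊√(a(a+d))⌋ = a for d ≤ 2, because a² ≤ a(a+d) ≤ a(a+2) < (a+1)².
-- This labels three of the four edges of each square.
geoLabel-near : ∀ a d → d ≤ 2 → GeoLabel a (d + a) a
geoLabel-near a d d≤2 = inj₁ (floorSqrt-intro (a * (d + a)) a
  (*-monoʳ-≤ a (m≤n+m a d))
  (≤-<-trans (*-monoʳ-≤ a (+-monoˡ-≤ a d≤2)) (<-≤-trans (n<1+n _) (≤-reflexive (square-suc a)))))
  where
  square-suc : ∀ a → suc (a * (2 + a)) ≡ suc a * suc a
  square-suc = solve-∀

-- ⌈√(a(a+4))⌉ = a + 2 for a ≥ 1, because (a+1)² < a(a+4) ≤ (a+2)²;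
-- this labels the path edge u_i u_{i+1}.
geoLabel-gap4 : ∀ a → 1 ≤ a → GeoLabel a (4 + a) (2 + a)
geoLabel-gap4 (suc c) _ = inj₂ (ceilSqrt-intro _ (2 + c)
  (≤-trans (m≤m+n _ (c + c)) (≤-reflexive (below c)))
  (≤-trans (m≤n+m _ 4) (≤-reflexive (above c))))
  where
  below : ∀ c → suc ((2 + c) * (2 + c)) + (c + c) ≡ suc c * (5 + c)
  below = solve-∀
  above : ∀ c → 4 + suc c * (5 + c) ≡ (3 + c) * (3 + c)
  above = solve-∀

digits-bound : ∀ {n m r t} → r < n → t < m → r + t * n < m * n
digits-bound {n} {m} {r} {t} r<n t<m = ≤-trans (+-monoˡ-< (t * n) r<n) (*-monoˡ-≤ n t<m)

digits-unique : ∀ {n r r′ t t′} .{{_ : NonZero n}} → r < n → r′ < n →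
                r + t * n ≡ r′ + t′ * n → r ≡ r′ × t ≡ t′
digits-unique {n} {r} {r′} {t} {t′} r<n r′<n eq = r≡r′ , t≡t′
  where
  open ≡-Reasoning
  r≡r′ : r ≡ r′
  r≡r′ = begin
    r                 ≡⟨ m<n⇒m%n≡m r<n ⟨
    r % n             ≡⟨ [m+kn]%n≡m%n r t n ⟨
    (r + t * n) % n   ≡⟨ cong (_% n) eq ⟩
    (r′ + t′ * n) % n ≡⟨ [m+kn]%n≡m%n r′ t′ n ⟩
    r′ % n            ≡⟨ m<n⇒m%n≡m r′<n ⟩
    r′                ∎
  t≡t′ : t ≡ t′
  t≡t′ = *-cancelʳ-≡ t t′ n (+-cancelˡ-≡ r _ _ (trans eq (cong (_+ t′ * n) (sym r≡r′))))

digits-exist : ∀ {m n} .{{_ : NonZero n}} d → d < m * n →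
               Σ (Fin m) λ i → Σ ℕ λ r → r < n × d ≡ r + toℕ i * n
digits-exist {m} {n} d d<mn = fromℕ< q<m , d % n , m%n<n d n ,
  trans (m≡m%n+[m/n]*n d n) (cong (λ q → d % n + q * n) (sym (toℕ-fromℕ< q<m)))
  where
  q<m : d / n < m
  q<m = m<n*o⇒m/o<n d<mn

length-concatMap-const : ∀ {A B : Set} (f : A → List B) c → (∀ x → length (f x) ≡ c) →
                         ∀ xs → length (concatMap f xs) ≡ length xs * c
length-concatMap-const f c len-f [] = refl
length-concatMap-const f c len-f (x ∷ xs) =
  trans (length-++ (f x)) (cong₂ _+_ (len-f x) (length-concatMap-const f c len-f xs))

isKGeometricMean-intro : ∀ k G q → size G ≡ q → (ψ : V G → ℕ) → Injective _≡_ _≡_ ψ →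
  (∀ x → k ≤ ψ x × ψ x ≤ k + q) → (L : List ℕ) →
  Pointwise (λ e l → GeoLabel (ψ (proj₁ e)) (ψ (proj₂ e)) l) (edges G) L →
  (∀ l → l ∈ L → k ≤ l × l < k + q) → (∀ l → k ≤ l → l < k + q → l ∈ L) →
  IsKGeometricMean k G
isKGeometricMean-intro k G q refl ψ ψ-inj ψ-range L labelled L-range L-complete =
  ψ , ψ-inj , ψ-range , L , labelled , L-range , L-complete

module SnakeLabelling (k : ℕ) (k≥1 : 1 ≤ k) (m : ℕ) where

  offset : QV m → ℕ
  offset (u _) = 0
  offset (v _) = 1
  offset (w _) = 3

  index : QV m → ℕ
  index (u i) = toℕ i
  index (v i) = toℕ i
  index (w i) = toℕ i

  ψ : QV m → ℕ
  ψ x = offset x + index x * 4 + k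

  offset<4 : ∀ x → offset x < 4
  offset<4 (u _) = s≤s z≤n
  offset<4 (v _) = s≤s (s≤s z≤n)
  offset<4 (w _) = s≤s (s≤s (s≤s (s≤s z≤n)))

  vertex-determined : ∀ x y → offset x ≡ offset y → index x ≡ index y → x ≡ y
  vertex-determined (u i) (u j) _ i≡j = cong u (toℕ-injective i≡j)
  vertex-determined (v i) (v j) _ i≡j = cong v (toℕ-injective i≡j)
  vertex-determined (w i) (w j) _ i≡j = cong w (toℕ-injective i≡j)
  vertex-determined (u _) (v _) () _
  vertex-determined (u _) (w _) () _
  vertex-determined (v _) (u _) () _
  vertex-determined (v _) (w _) () _
  vertex-determined (w _) (u _) () _
  vertex-determined (w _) (v _) () _

  ψ-injective : Injective _≡_ _≡_ ψ
  ψ-injective {x} {y} ψx≡ψy =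
    let (same-offset , same-index) = digits-unique (offset<4 x) (offset<4 y) (+-cancelʳ-≡ k _ _ ψx≡ψy)
    in vertex-determined x y same-offset same-index

  position≤ : ∀ x → offset x + index x * 4 ≤ m * 4
  position≤ (u i) = *-monoˡ-≤ 4 (s≤s⁻¹ (toℕ<n i))
  position≤ (v i) = <⇒≤ (digits-bound (offset<4 (v i)) (toℕ<n i))
  position≤ (w i) = <⇒≤ (digits-bound (offset<4 (w i)) (toℕ<n i))

  ψ-range : ∀ x → k ≤ ψ x × ψ x ≤ k + m * 4
  ψ-range x = m≤n+m k _ , subst (ψ x ≤_) (+-comm _ k) (+-monoˡ-≤ k (position≤ x))

  labelOffsets : List ℕ
  labelOffsets = 2 ∷ 0 ∷ 1 ∷ 3 ∷ []

  labelOffset<4 : ∀ {r} → r ∈ labelOffsets → r < 4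
  labelOffset<4 (here refl) = s≤s (s≤s (s≤s z≤n))
  labelOffset<4 (there (here refl)) = s≤s z≤n
  labelOffset<4 (there (there (here refl))) = s≤s (s≤s z≤n)
  labelOffset<4 (there (there (there (here refl)))) = s≤s (s≤s (s≤s (s≤s z≤n)))

  labelOffset-complete : ∀ r → r < 4 → r ∈ labelOffsets
  labelOffset-complete 0 _ = there (here refl)
  labelOffset-complete 1 _ = there (there (here refl))
  labelOffset-complete 2 _ = here refl
  labelOffset-complete 3 _ = there (there (there (here refl)))
  labelOffset-complete (suc (suc (suc (suc r)))) (s≤s (s≤s (s≤s (s≤s ()))))

  squareLabels : Fin m → List ℕ
  squareLabels i = map (λ r → r + toℕ i * 4 + k) labelOffsets

  labels : List ℕ
  labels = concatMap squareLabels (allFin m)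

  EdgeLabel : QV m × QV m → ℕ → Set
  EdgeLabel (x , y) l = GeoLabel (ψ x) (ψ y) l

  square-labelled : ∀ i → Pointwise EdgeLabel (qEdges m i) (squareLabels i)
  square-labelled i =
    subst (λ a → GeoLabel a (4 + b) (2 + b)) base (geoLabel-gap4 b b≥1)
    ∷ subst (λ a → GeoLabel a (1 + b) b) base (geoLabel-near b 1 (s≤s z≤n))
    ∷ geoLabel-near (1 + b) 2 ≤-refl
    ∷ geoLabel-near (3 + b) 1 (s≤s z≤n)
    ∷ []
    where
    b = toℕ i * 4 + k
    b≥1 : 1 ≤ b
    b≥1 = ≤-trans k≥1 (m≤n+m k _)
    base : b ≡ ψ (u (inject₁ i))
    base = cong (λ t → t * 4 + k) (sym (toℕ-inject₁ i))

  all-labelled : ∀ is → Pointwise EdgeLabel (concatMap (qEdges m) is) (concatMap squareLabels is)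
  all-labelled [] = []
  all-labelled (i ∷ is) = ++⁺ (square-labelled i) (all-labelled is)

  size≡ : size (Q (suc m)) ≡ m * 4
  size≡ = trans (length-concatMap-const (qEdges m) 4 (λ _ → refl) (allFin m))
                (cong (_* 4) (length-tabulate {n = m} (λ i → i)))

  labels-range : ∀ l → l ∈ labels → k ≤ l × l < k + m * 4
  labels-range l l∈labels with satisfied (∈-concatMap⁻ squareLabels {xs = allFin m} l∈labels)
  ... | i , l∈square with ∈-map⁻ (λ r → r + toℕ i * 4 + k) l∈square
  ... | r , r∈offsets , refl =
    m≤n+m k _ , subst (_< k + m * 4) (+-comm k _) (+-monoʳ-< k (digits-bound (labelOffset<4 r∈offsets) (toℕ<n i)))

  labels-complete : ∀ l → k ≤ l → l < k + m * 4 → l ∈ labels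
  labels-complete l k≤l l<k+4m with digits-exist {m} {4} (l ∸ k) d<4m
    where
    d<4m : l ∸ k < m * 4
    d<4m = +-cancelʳ-< k _ _ (subst₂ _<_ (sym (m∸n+n≡m k≤l)) (+-comm k _) l<k+4m)
  ... | i , r , r<4 , d≡ = ∈-concatMap⁺ squareLabels (lose (∈-allFin i) l∈square)
    where
    l≡ : l ≡ r + toℕ i * 4 + k
    l≡ = trans (sym (m∸n+n≡m k≤l)) (cong (_+ k) d≡)
    l∈square : l ∈ squareLabels i
    l∈square = subst (_∈ squareLabels i) (sym l≡) (∈-map⁺ (λ r → r + toℕ i * 4 + k) (labelOffset-complete r r<4))

  snake-isKGeometricMean : IsKGeometricMean k (Q (suc m))
  snake-isKGeometricMean = isKGeometricMean-intro k (Q (suc m)) (m * 4) size≡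
    ψ ψ-injective ψ-range labels (all-labelled (allFin m)) labels-range labels-complete

mainTheorem9 : (n k : ℕ) → 1 ≤ n → 1 ≤ k → IsKGeometricMean k (Q n)
mainTheorem9 (suc m) k _ k≥1 = SnakeLabelling.snake-isKGeometricMean k k≥1 m
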